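{- Let $G$ be a simple connected graph of order $n$ with matching number $\beta$. Then $G$ has a spanning tree $T$ whose matching number is $\beta$.
   Context: The matching number of a graph is the maximum number of pairwise disjoint edges in it. -}

module Defs where

open import Data.Nat using (ℕ; _≤_)
open import Data.Bool using (Bool; true)
open import Data.Fin using (Fin)
open import Data.List using (List; []; _∷_; _++_; [_]; length)
open import Data.List.Relation.Unary.All using (All)
open import Data.List.Relation.Unary.Linked using (Linked)
open import Data.List.Relation.Unary.Unique.Propositional using (Unique)
open import Data.Product using (Σ; _×_; _,_; proj₁; proj₂)
open import Relation.Binary.PropositionalEquality using (_≡_)
open import Relation.Nullary using (¬_)

record Graph (n : ℕ) : Set where
  field
    adj    : Fin n → Fin n → Bool
    sym    : ∀ u v → adj u v ≡ adj v u
    irrefl : ∀ v → ¬ (adj v v ≡ true)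
open Graph public

Adj : ∀ {n} → Graph n → Fin n → Fin n → Set
Adj G u v = adj G u v ≡ true

data Walk {n} (G : Graph n) : Fin n → Fin n → Set where
  here : ∀ {v} → Walk G v v
  step : ∀ {u w v} → Adj G u w → Walk G w v → Walk G u v

Connected : ∀ {n} → Graph n → Set
Connected G = ∀ u v → Walk G u v

record Cycle {n} (G : Graph n) : Set where
  field
    x y z  : Fin n
    rest   : List (Fin n)
    dist   : Unique (x ∷ y ∷ z ∷ rest)
    closed : Linked (Adj G) ((x ∷ y ∷ z ∷ rest) ++ [ x ])

Acyclic : ∀ {n} → Graph n → Set
Acyclic G = ¬ Cycle G

IsTree : ∀ {n} → Graph n → Set
IsTree G = Connected G × Acyclic G

SpanningSubgraph : ∀ {n} → Graph n → Graph n → Set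
SpanningSubgraph T G = ∀ u v → Adj T u v → Adj G u v

IsSpanningTree : ∀ {n} → Graph n → Graph n → Set
IsSpanningTree T G = SpanningSubgraph T G × IsTree T

endpoints : ∀ {n} → List (Fin n × Fin n) → List (Fin n)
endpoints [] = []
endpoints ((u , v) ∷ es) = u ∷ v ∷ endpoints es

IsMatching : ∀ {n} → Graph n → List (Fin n × Fin n) → Set
IsMatching G M = All (λ e → Adj G (proj₁ e) (proj₂ e)) M × Unique (endpoints M)

IsMatchingNumber : ∀ {n} → Graph n → ℕ → Set
IsMatchingNumber G β =
  (Σ (List _) λ M → IsMatching G M × length M ≡ β)
  × (∀ M → IsMatching G M → length M ≤ β)

{-# OPTIONS --safe #-}
-- Take a maximum matching M of G.  It suffices to find a spanning tree containing
-- M, because every matching of a spanning subgraph is a matching of G.  Rank the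
-- vertices lexicographically by distance to a root and by index, and let every
-- other vertex point to a neighbour of smaller rank, namely its matching partner
-- whenever the partner has smaller rank.  Following pointers lowers the rank, so
-- the pointer graph is connected, and it is acyclic because a cycle would contain
-- a vertex of locally maximal rank, i.e. a vertex with two parents.  Of two
-- matched vertices the higher one points to the other, so M lies in the tree.
module Submission where

open import Defs
open import Data.Nat using (ℕ)
open import Data.Product using (Σ; _×_)

open import Data.Nat using (zero; suc; _+_; _*_; _≤_; _<_; s≤s)
import Data.Nat.Properties as ℕ
open import Data.Nat.Induction using (<-rec)
open import Data.Fin as Fin using (Fin; toℕ)
import Data.Fin.Properties as Fin
open import Data.Bool as Bool using (true)
open import Data.Bool.Properties using (∨-comm)
open import Data.List using (List; []; _∷_; _++_; [_]; map)
open import Data.List.Relation.Unary.All as All using (All; []; _∷_)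
open import Data.List.Relation.Unary.Any using (here; there)
open import Data.List.Relation.Unary.AllPairs as AllPairs using (_∷_)
open import Data.List.Relation.Unary.Linked as Linked using (Linked; [-]; _∷_)
open import Data.List.Relation.Unary.Linked.Properties using (Linked⇒AllPairs)
open import Data.List.Relation.Unary.Unique.Propositional using (Unique)
open import Data.List.Membership.Propositional using (_∈_; _∉_)
open import Data.List.Membership.Propositional.Properties using (∈-map⁺; ∈-++⁺ʳ)
open import Data.Product using (_,_; proj₁; proj₂; ∃-syntax; Σ-syntax)
open import Data.Product.Properties using (≡-dec)
open import Data.Sum using (_⊎_; inj₁; inj₂; reduce)
open import Data.Unit using (⊤; tt)
open import Data.Empty using (⊥)
open import Function using (_on_; flip)
open import Relation.Nullary using (¬_; Dec; yes; no; does; proof; contradiction)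
open import Relation.Nullary.Reflects using (Reflects; invert)
open import Relation.Nullary.Decidable using (_×-dec_; _⊎-dec_; dec-true)
open import Relation.Binary using (Transitive; tri<; tri≈; tri>)
open import Relation.Binary.PropositionalEquality using (_≡_; _≢_; refl; trans; cong; subst; ≢-sym)

least : ∀ {P : ℕ → Set} → (∀ k → Dec (P k)) → ∀ {m} → P m →
        ∃[ k ] P k × (∀ {j} → P j → k ≤ j)
least {P} P? {m} = <-rec Least search m
  where
  Least : ℕ → Set
  Least m = P m → ∃[ k ] P k × (∀ {j} → P j → k ≤ j)

  search : ∀ m → (∀ {j} → j < m → Least j) → Least m
  search m smaller pm with ℕ.anyUpTo? P? m
  ... | yes (j , j<m , pj) = smaller j<m pj
  ... | no none            = m , pm , λ {j} pj → ℕ.≮⇒≥ λ j<m → none (j , j<m , pj)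

lex-< : ∀ {n a b} (i j : Fin n) → a < b → a * n + toℕ i < b * n + toℕ j
lex-< {n} {a} {b} i j a<b = begin-strict
  a * n + toℕ i  <⟨ ℕ.+-monoʳ-< (a * n) (Fin.toℕ<n i) ⟩
  a * n + n      ≡⟨ ℕ.+-comm (a * n) n ⟩
  suc a * n      ≤⟨ ℕ.*-monoˡ-≤ n a<b ⟩
  b * n          ≤⟨ ℕ.m≤m+n (b * n) (toℕ j) ⟩
  b * n + toℕ j  ∎
  where open ℕ.≤-Reasoning

lex-cmp : ∀ {n} a b (i j : Fin n) → i ≢ j →
          a * n + toℕ i < b * n + toℕ j ⊎ b * n + toℕ j < a * n + toℕ i
lex-cmp a b i j i≢j with ℕ.<-cmp a b
... | tri< a<b _ _ = inj₁ (lex-< i j a<b)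
... | tri> _ _ b<a = inj₂ (lex-< j i b<a)
... | tri≈ _ refl _ with Fin.<-cmp i j
...   | tri< i<j _ _ = inj₁ (ℕ.+-monoʳ-< (a * _) i<j)
...   | tri≈ _ i≡j _ = contradiction i≡j i≢j
...   | tri> _ _ j<i = inj₂ (ℕ.+-monoʳ-< (a * _) j<i)

linked⇒head∉tail : ∀ {A : Set} {R : A → A → Set} → Transitive R → (∀ {a} → ¬ R a a) →
                   ∀ {a l} → Linked R (a ∷ l) → a ∉ l
linked⇒head∉tail transitive irrefl chain a∈l =
  irrefl (All.lookup (AllPairs.head (Linked⇒AllPairs transitive chain)) a∈l)

linked-snoc : ∀ {A : Set} {R : A → A → Set} {x y} l →
              Linked R (l ++ [ x ]) → R x y → Linked R (l ++ x ∷ y ∷ [])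
linked-snoc []          _            xy = xy ∷ [-]
linked-snoc (a ∷ [])    (ax ∷ _)     xy = ax ∷ xy ∷ [-]
linked-snoc (a ∷ b ∷ l) (ab ∷ chain) xy = ab ∷ linked-snoc (b ∷ l) chain xy

NonBacktracking : ∀ {A : Set} → List A → Set
NonBacktracking (a ∷ b ∷ c ∷ l) = a ≢ c × NonBacktracking (b ∷ c ∷ l)
NonBacktracking _               = ⊤

nonBacktracking-++ : ∀ {A : Set} {x y : A} l → Unique l → All (x ≢_) l → All (y ≢_) l →
                     NonBacktracking (l ++ x ∷ y ∷ [])
nonBacktracking-++ []              _                  _          _         = tt
nonBacktracking-++ (a ∷ [])        _                  _          (y≢a ∷ _) = ≢-sym y≢a , tt
nonBacktracking-++ (a ∷ b ∷ [])    (_ ∷ u)            (x≢a ∷ x∉) (_ ∷ y∉)  =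
  ≢-sym x≢a , nonBacktracking-++ (b ∷ []) u x∉ y∉
nonBacktracking-++ (a ∷ b ∷ c ∷ l) ((_ ∷ a≢c ∷ _) ∷ u) (_ ∷ x∉)   (_ ∷ y∉)  =
  a≢c , nonBacktracking-++ (b ∷ c ∷ l) u x∉ y∉

cycle-nonBacktracking : ∀ {A : Set} {x y z : A} rest → Unique (x ∷ y ∷ z ∷ rest) →
                        NonBacktracking (x ∷ y ∷ z ∷ rest ++ x ∷ y ∷ [])
cycle-nonBacktracking [] ((x≢y ∷ x∉@(x≢z ∷ _)) ∷ y∉ ∷ u) =
  x≢z , ≢-sym x≢y , nonBacktracking-++ (_ ∷ []) u x∉ y∉
cycle-nonBacktracking (c ∷ rest) ((_ ∷ x∉@(x≢z ∷ _)) ∷ y∉@(_ ∷ y≢c ∷ _) ∷ u) =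
  x≢z , y≢c , nonBacktracking-++ (_ ∷ c ∷ rest) u x∉ y∉

LastStep : ∀ {A : Set} → (A → A → Set) → List A → Set
LastStep R (a ∷ b ∷ [])    = R a b
LastStep R (a ∷ b ∷ c ∷ l) = LastStep R (b ∷ c ∷ l)
LastStep R _               = ⊥

lastStep-++ : ∀ {A : Set} {R : A → A → Set} {a b} l → R a b → LastStep R (l ++ a ∷ b ∷ [])
lastStep-++ []              ab = ab
lastStep-++ (c ∷ [])        ab = ab
lastStep-++ (c ∷ d ∷ [])    ab = ab
lastStep-++ (c ∷ d ∷ e ∷ l) ab = lastStep-++ (d ∷ e ∷ l) ab

adj? : ∀ {n} (G : Graph n) u v → Dec (Adj G u v)
adj? G u v = adj G u v Bool.≟ true

adj-sym : ∀ {n} (G : Graph n) {u v} → Adj G u v → Adj G v u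
adj-sym G {u} {v} uv = trans (Graph.sym G v u) uv

module _ {n} {G : Graph n} where

  _++ʷ_ : ∀ {u v w} → Walk G u v → Walk G v w → Walk G u w
  here     ++ʷ q = q
  step a p ++ʷ q = step a (p ++ʷ q)

  reverseʷ : ∀ {u v} → Walk G u v → Walk G v u
  reverseʷ here       = here
  reverseʷ (step a p) = reverseʷ p ++ʷ step (adj-sym G a) here

  connected-via : (r : Fin n) → (∀ v → Walk G v r) → Connected G
  connected-via r to-r u v = to-r u ++ʷ reverseʷ (to-r v)

module Distance {n} (G : Graph n) (r : Fin n) (conn : Connected G) where

  ReachesIn : ℕ → Fin n → Set
  ReachesIn zero    v = v ≡ r
  ReachesIn (suc k) v = ∃[ u ] Adj G v u × ReachesIn k u

  reachesIn? : ∀ k v → Dec (ReachesIn k v)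
  reachesIn? zero    v = v Fin.≟ r
  reachesIn? (suc k) v = Fin.any? λ u → adj? G v u ×-dec reachesIn? k u

  walk⇒reachesIn : ∀ {v} → Walk G v r → ∃[ k ] ReachesIn k v
  walk⇒reachesIn here       = zero , refl
  walk⇒reachesIn (step a w) = let k , reach = walk⇒reachesIn w in suc k , _ , a , reach

  shortest : ∀ v → ∃[ k ] ReachesIn k v × (∀ {j} → ReachesIn j v → k ≤ j)
  shortest v = least (λ k → reachesIn? k v) (proj₂ (walk⇒reachesIn (conn v r)))

  distance : Fin n → ℕ
  distance v = proj₁ (shortest v)

  distance-minimal : ∀ {k v} → ReachesIn k v → distance v ≤ k
  distance-minimal {v = v} = proj₂ (proj₂ (shortest v))

  closer-neighbour : ∀ {k v} → ReachesIn k v → v ≢ r → ∃[ u ] Adj G v u × distance u < k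
  closer-neighbour {zero}  v≡r             v≢r = contradiction v≡r v≢r
  closer-neighbour {suc k} (u , vu , reach) _  = u , vu , s≤s (distance-minimal reach)

  distance-descends : ∀ v → v ≢ r → ∃[ u ] Adj G v u × distance u < distance v
  distance-descends v = closer-neighbour (proj₁ (proj₂ (shortest v)))

module Forest {n} (parent : Fin n → Fin n) (rank : Fin n → ℕ) where

  -- A pointer that does not lower the rank (such as the root's) yields no edge.
  ChildOf : Fin n → Fin n → Set
  ChildOf u v = parent u ≡ v × rank v < rank u

  childOf? : ∀ u v → Dec (ChildOf u v)
  childOf? u v = (parent u Fin.≟ v) ×-dec (rank v ℕ.<? rank u)

  edge? : ∀ u v → Dec (ChildOf u v ⊎ ChildOf v u)
  edge? u v = childOf? u v ⊎-dec childOf? v u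

  edge⁻ : ∀ {u v} → does (edge? u v) ≡ true → ChildOf u v ⊎ ChildOf v u
  edge⁻ {u} {v} e = invert (subst (Reflects _) e (proof (edge? u v)))

  forest : Graph n
  forest = record
    { adj    = λ u v → does (edge? u v)
    ; sym    = λ u v → ∨-comm (does (childOf? u v)) (does (childOf? v u))
    ; irrefl = λ v e → ℕ.<-irrefl refl (proj₂ (reduce (edge⁻ e)))
    }

  adj⁺ : ∀ {u v} → ChildOf u v ⊎ ChildOf v u → Adj forest u v
  adj⁺ = dec-true (edge? _ _)

  forest-spanning : (G : Graph n) → (∀ v → rank (parent v) < rank v → Adj G v (parent v)) →
                    SpanningSubgraph forest G
  forest-spanning G parent-adj u v e with edge⁻ e
  ... | inj₁ (refl , lt) = parent-adj u lt
  ... | inj₂ (refl , lt) = adj-sym G (parent-adj v lt)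

  forest-connected : (r : Fin n) → (∀ v → v ≢ r → rank (parent v) < rank v) → Connected forest
  forest-connected r descends = connected-via r λ v → climb (suc (rank v)) v ℕ.≤-refl
    where
    climb : ∀ fuel v → rank v < fuel → Walk forest v r
    climb (suc fuel) v rank<fuel with v Fin.≟ r
    ... | yes refl = here
    ... | no v≢r   = step (adj⁺ (inj₁ (refl , descends v v≢r)))
                          (climb fuel (parent v) (ℕ.<-≤-trans (descends v v≢r) (ℕ.≤-pred rank<fuel)))

  rank-step : ∀ {a b} → Adj forest a b → rank a < rank b ⊎ rank b < rank a
  rank-step e with edge⁻ e
  ... | inj₁ (_ , b<a) = inj₂ b<a
  ... | inj₂ (_ , a<b) = inj₁ a<b

  -- The only lower neighbour of a vertex is its parent.
  ascent-continues : ∀ {a b c} → Adj forest a b → Adj forest b c → a ≢ c →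
                     rank a < rank b → rank b < rank c
  ascent-continues ab bc a≢c a<b with edge⁻ ab | edge⁻ bc
  ... | inj₁ (_ , b<a)  | _                = contradiction b<a (ℕ.<-asym a<b)
  ... | inj₂ (refl , _) | inj₁ (refl , _)  = contradiction refl a≢c
  ... | inj₂ _          | inj₂ (_ , b<c)   = b<c

  ascending : ∀ {a b l} → Linked (Adj forest) (a ∷ b ∷ l) → NonBacktracking (a ∷ b ∷ l) →
              rank a < rank b → Linked (_<_ on rank) (a ∷ b ∷ l)
  ascending {l = []}    _                     _         a<b = a<b ∷ [-]
  ascending {l = _ ∷ _} (ab ∷ walk@(bc ∷ _)) (a≢c , nb) a<b =
    a<b ∷ ascending walk nb (ascent-continues ab bc a≢c a<b)

  descending : ∀ {a b l} → Linked (Adj forest) (a ∷ b ∷ l) → NonBacktracking (a ∷ b ∷ l) →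
               LastStep (flip _<_ on rank) (a ∷ b ∷ l) → Linked (flip _<_ on rank) (a ∷ b ∷ l)
  descending {l = []}    _                     _          b<a  = b<a ∷ [-]
  descending {l = _ ∷ _} (ab ∷ walk@(bc ∷ _)) (a≢c , nb) last with descending walk nb last
  ... | rest@(c<b ∷ _) with rank-step ab
  ...   | inj₂ b<a = b<a ∷ rest
  ...   | inj₁ a<b = contradiction (ascent-continues ab bc a≢c a<b) (ℕ.<-asym c<b)

  -- The walk repeats its first edge at its end, so by the two lemmas above it is
  -- monotone in rank; yet it returns to x.
  no-closed-walk : ∀ {x y} l → Linked (Adj forest) (x ∷ y ∷ l ++ x ∷ y ∷ []) →
                   ¬ NonBacktracking (x ∷ y ∷ l ++ x ∷ y ∷ [])
  no-closed-walk {x} {y} l walk nb = either-direction (rank-step (Linked.head walk))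
    where
    x-returns : x ∈ (y ∷ l) ++ x ∷ y ∷ []
    x-returns = ∈-++⁺ʳ (y ∷ l) (here refl)

    either-direction : rank x < rank y ⊎ rank y < rank x → ⊥
    either-direction (inj₁ x<y) =
      linked⇒head∉tail ℕ.<-trans (ℕ.<-irrefl refl) (ascending walk nb x<y) x-returns
    either-direction (inj₂ y<x) =
      linked⇒head∉tail (flip ℕ.<-trans) (ℕ.<-irrefl refl)
        (descending walk nb (lastStep-++ (x ∷ y ∷ l) y<x)) x-returns

  forest-acyclic : Acyclic forest
  forest-acyclic c =
    no-closed-walk (z ∷ rest) (linked-snoc (x ∷ y ∷ z ∷ rest) closed (Linked.head closed))
                   (cycle-nonBacktracking rest dist)
    where open Cycle c

darts : ∀ {A : Set} → List (A × A) → List (A × A)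
darts []             = []
darts ((u , v) ∷ es) = (u , v) ∷ (v , u) ∷ darts es

endpoints≡map-proj₁-darts : ∀ {n} (M : List (Fin n × Fin n)) → endpoints M ≡ map proj₁ (darts M)
endpoints≡map-proj₁-darts []             = refl
endpoints≡map-proj₁-darts ((u , v) ∷ es) = cong (λ l → u ∷ v ∷ l) (endpoints≡map-proj₁-darts es)

∈-darts : ∀ {A : Set} {M : List (A × A)} {a b} → (a , b) ∈ M → (a , b) ∈ darts M × (b , a) ∈ darts M
∈-darts {M = _ ∷ _} (here refl) = here refl , there (here refl)
∈-darts {M = _ ∷ _} (there ab∈M) =
  let ab , ba = ∈-darts ab∈M in there (there ab) , there (there ba)

unique-keys⇒functional : ∀ {A B : Set} (L : List (A × B)) → Unique (map proj₁ L) →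
                         ∀ {k a b} → (k , a) ∈ L → (k , b) ∈ L → a ≡ b
unique-keys⇒functional (_ ∷ _) _        (here refl) (here refl) = refl
unique-keys⇒functional (_ ∷ _) (k∉ ∷ _) (here refl) (there kb)  =
  contradiction refl (All.lookup k∉ (∈-map⁺ proj₁ kb))
unique-keys⇒functional (_ ∷ _) (k∉ ∷ _) (there ka)  (here refl) =
  contradiction refl (All.lookup k∉ (∈-map⁺ proj₁ ka))
unique-keys⇒functional (_ ∷ L) (_ ∷ u)  (there ka)  (there kb)  = unique-keys⇒functional L u ka kb

module Matching {n} (G : Graph n) {M : List (Fin n × Fin n)} (matching : IsMatching G M) where

  Matched : Fin n → Fin n → Set
  Matched v w = (v , w) ∈ darts M

  matched? : ∀ v w → Dec (Matched v w)
  matched? v w = (v , w) ∈? darts M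
    where open import Data.List.Membership.DecPropositional (≡-dec Fin._≟_ Fin._≟_) using (_∈?_)

  matched-functional : ∀ {v w w′} → Matched v w → Matched v w′ → w ≡ w′
  matched-functional =
    unique-keys⇒functional (darts M) (subst Unique (endpoints≡map-proj₁-darts M) (proj₂ matching))

  matched-adj : ∀ {v w} → Matched v w → Adj G v w
  matched-adj = All.lookup (darts-adj (proj₁ matching))
    where
    darts-adj : ∀ {es} → All (λ e → Adj G (proj₁ e) (proj₂ e)) es →
                All (λ e → Adj G (proj₁ e) (proj₂ e)) (darts es)
    darts-adj []        = []
    darts-adj (uv ∷ es) = uv ∷ adj-sym G uv ∷ darts-adj es

  matching-loopless : ∀ {a b} → (a , b) ∈ M → a ≢ b
  matching-loopless = loopless M (proj₂ matching)
    where
    loopless : ∀ es → Unique (endpoints es) → ∀ {a b} → (a , b) ∈ es → a ≢ b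
    loopless (_ ∷ _)  ((a≢b ∷ _) ∷ _) (here refl) = a≢b
    loopless (_ ∷ es) (_ ∷ _ ∷ u)     (there p)   = loopless es u p

module MatchingTree {n} (G : Graph n) (conn : Connected G) (r : Fin n)
                    {M} (matching : IsMatching G M) where

  open Distance G r conn
  open Matching G matching

  rank : Fin n → ℕ
  rank v = distance v * n + toℕ v

  lowerPartner? : ∀ v → Dec (∃[ w ] Matched v w × rank w < rank v)
  lowerPartner? v = Fin.any? λ w → matched? v w ×-dec rank w ℕ.<? rank v

  lowerNeighbour? : ∀ v → Dec (∃[ u ] Adj G v u × rank u < rank v)
  lowerNeighbour? v = Fin.any? λ u → adj? G v u ×-dec rank u ℕ.<? rank v

  parent : Fin n → Fin n
  parent v with lowerPartner? v
  ... | yes (w , _) = w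
  ... | no _ with lowerNeighbour? v
  ...   | yes (u , _) = u
  ...   | no _        = v

  parent-descends : ∀ v → v ≢ r → rank (parent v) < rank v
  parent-descends v v≢r with lowerPartner? v
  ... | yes (_ , _ , lt) = lt
  ... | no _ with lowerNeighbour? v
  ...   | yes (_ , _ , lt) = lt
  ...   | no none = let u , vu , closer = distance-descends v v≢r in
                    contradiction (u , vu , lex-< u v closer) none

  parent-adj : ∀ v → rank (parent v) < rank v → Adj G v (parent v)
  parent-adj v lt with lowerPartner? v
  ... | yes (_ , vw , _) = matched-adj vw
  ... | no _ with lowerNeighbour? v
  ...   | yes (_ , vu , _) = vu
  ...   | no _             = contradiction lt (ℕ.<-irrefl refl)

  parent-partner : ∀ {v w} → Matched v w → rank w < rank v → parent v ≡ w
  parent-partner {v} {w} vw lt with lowerPartner? v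
  ... | yes (_ , vw′ , _) = matched-functional vw′ vw
  ... | no none           = contradiction (w , vw , lt) none

  open Forest parent rank public

  forest-contains-matching : All (λ e → Adj forest (proj₁ e) (proj₂ e)) M
  forest-contains-matching = All.tabulate λ {(a , b)} ab∈M →
    let ab , ba = ∈-darts ab∈M in
    adj⁺ (orient ab ba (lex-cmp (distance a) (distance b) a b (matching-loopless ab∈M)))
    where
    orient : ∀ {a b} → Matched a b → Matched b a → rank a < rank b ⊎ rank b < rank a →
             ChildOf a b ⊎ ChildOf b a
    orient _  ba (inj₁ a<b) = inj₂ (parent-partner ba a<b , a<b)
    orient ab _  (inj₂ b<a) = inj₁ (parent-partner ab b<a , b<a)

spanningTree-containing-matching : ∀ {n} (G : Graph n) {M} → Connected G → IsMatching G M →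
                                   Σ[ T ∈ Graph n ] IsSpanningTree T G × IsMatching T M
spanningTree-containing-matching {zero}  G conn matching =
  G , ((λ _ _ uv → uv) , conn , λ c → Fin.¬Fin0 (Cycle.x c)) , matching
spanningTree-containing-matching {suc n} G conn matching =
  forest ,
  (forest-spanning G parent-adj , forest-connected Fin.zero parent-descends , forest-acyclic) ,
  (forest-contains-matching , proj₂ matching)
  where open MatchingTree G conn Fin.zero matching

spanningSubgraph-matching : ∀ {n} {T G : Graph n} {M} →
                            SpanningSubgraph T G → IsMatching T M → IsMatching G M
spanningSubgraph-matching T⊆G (inT , unique) = All.map (T⊆G _ _) inT , unique

theorem2p1 : ∀ (n : ℕ) (G : Graph n) (β : ℕ) → Connected G → IsMatchingNumber G β
    → Σ (Graph n) λ T → IsSpanningTree T G × IsMatchingNumber T β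
theorem2p1 n G β conn ((M , matching , |M|≡β) , maximum)
  with spanningTree-containing-matching G conn matching
... | T , spanningTree@(T⊆G , _) , matchingT =
  T , spanningTree , (M , matchingT , |M|≡β) ,
  λ M′ m′ → maximum M′ (spanningSubgraph-matching {T = T} {G} T⊆G m′)
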